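{- Every jewel and every pyramid contains an induced subgraph isomorphic to $C_5$, to the bull, or to an anchor.
   Context: All graphs are finite and simple. The bull is the graph consisting of a triangle together with two disjoint pendant edges. A path $p_1-\dots-p_k$ is a sequence of distinct vertices with $p_i$ adjacent to $p_j$ iff $|i-j|=1$; its ends are $p_1,p_k$. An anchor is a six-vertex graph consisting of a 4-vertex induced path $P$, a vertex $c$ adjacent to all of $V(P)$, and a vertex $a$ adjacent to none of $V(P)$ (the pair $a,c$ may be adjacent or not). A pyramid is a graph formed by the union of a triangle $\{b_1,b_2,b_3\}$, a fourth vertex $a$, and three paths $P_1,P_2,P_3$ such that: for $i=1,2,3$, $P_i$ has ends $a$ and $b_i$; for $1\le i<j\le 3$, $a$ is the only vertex in both $P_i$ and $P_j$, and $b_ib_j$ is the only edge of the graph between $V(P_i)\setminus\{a\}$ and $V(P_j)\setminus\{a\}$; and $a$ is adjacent to at most one of $b_1,b_2,b_3$. A jewel is a graph $H$ with vertex set $\{v_1,v_2,v_3,v_4,v_5\}\cup F$ such that $H[F]$ is connected, $v_1v_2,v_2v_3,v_3v_4,v_4v_5,v_5v_1$ are edges, $v_1v_3,v_2v_4,v_1v_4$ are non-edges, each of $v_2,v_3,v_5$ has no neighbor in $F$, and each of $v_1,v_4$ has a neighbor in $F$. -}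

module Defs where

open import Data.Nat using (ℕ; zero; suc)
open import Data.Nat as ℕ using ()
open import Data.Fin using (Fin; zero; suc; toℕ; fromℕ)
open import Data.Bool using (Bool; true; false; _∨_; _∧_)
open import Data.Bool.Properties using (∨-comm)
open import Data.List using (List; []; _∷_)
open import Data.Bool.ListAction using (any)
open import Data.Product using (Σ; _×_; _,_)
open import Data.Sum using (_⊎_)
open import Relation.Nullary using (¬_)
open import Relation.Binary.PropositionalEquality using (_≡_; _≢_; refl)

record Graph : Set where
  field
    n      : ℕ
    adj    : Fin n → Fin n → Bool
    sym    : ∀ u v → adj u v ≡ adj v u
    irrefl : ∀ v → adj v v ≡ false

open Graph public

V : Graph → Set
V G = Fin (n G)

Edge : (G : Graph) → V G → V G → Set
Edge G u v = adj G u v ≡ true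

record Contains (G H : Graph) : Set where
  field
    f    : V H → V G
    inj  : ∀ i j → f i ≡ f j → i ≡ j
    pres : ∀ i j → adj H i j ≡ adj G (f i) (f j)

edgeIn : List (ℕ × ℕ) → ℕ → ℕ → Bool
edgeIn es i j = any (λ { (a , b) → (a ℕ.≡ᵇ i) ∧ (b ℕ.≡ᵇ j) }) es

mkGraph : (k : ℕ) → (es : List (ℕ × ℕ)) →
          (∀ (i : Fin k) → edgeIn es (toℕ i) (toℕ i) ≡ false) → Graph
mkGraph k es irr = record
  { n = k
  ; adj = λ i j → edgeIn es (toℕ i) (toℕ j) ∨ edgeIn es (toℕ j) (toℕ i)
  ; sym = λ i j → ∨-comm (edgeIn es (toℕ i) (toℕ j)) (edgeIn es (toℕ j) (toℕ i))
  ; irrefl = λ i → irr' i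
  }
  where
  irr' : ∀ (i : Fin k) → edgeIn es (toℕ i) (toℕ i) ∨ edgeIn es (toℕ i) (toℕ i) ≡ false
  irr' i with edgeIn es (toℕ i) (toℕ i) | irr i
  ... | false | _ = refl

C5 : Graph
C5 = mkGraph 5 ((0 , 1) ∷ (1 , 2) ∷ (2 , 3) ∷ (3 , 4) ∷ (4 , 0) ∷ [])
  (λ { zero → refl ; (suc zero) → refl ; (suc (suc zero)) → refl
     ; (suc (suc (suc zero))) → refl ; (suc (suc (suc (suc zero)))) → refl })

bull : Graph
bull = mkGraph 5 ((0 , 1) ∷ (1 , 2) ∷ (0 , 2) ∷ (0 , 3) ∷ (1 , 4) ∷ [])
  (λ { zero → refl ; (suc zero) → refl ; (suc (suc zero)) → refl
     ; (suc (suc (suc zero))) → refl ; (suc (suc (suc (suc zero)))) → refl })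

-- anchor: induced path P = 0-1-2-3, vertex c = 4 adjacent to all of P,
-- vertex a = 5 adjacent to none of P; a and c adjacent iff the flag is true
anchorEdges : Bool → List (ℕ × ℕ)
anchorEdges b = (0 , 1) ∷ (1 , 2) ∷ (2 , 3) ∷ (4 , 0) ∷ (4 , 1) ∷ (4 , 2) ∷ (4 , 3) ∷ rest b
  where
  rest : Bool → List (ℕ × ℕ)
  rest true  = (4 , 5) ∷ []
  rest false = []

anchor : Bool → Graph
anchor b = mkGraph 6 (anchorEdges b) (irr b)
  where
  irr : ∀ b (i : Fin 6) → edgeIn (anchorEdges b) (toℕ i) (toℕ i) ≡ false
  irr true zero = refl
  irr true (suc zero) = refl
  irr true (suc (suc zero)) = refl
  irr true (suc (suc (suc zero))) = refl
  irr true (suc (suc (suc (suc zero)))) = refl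
  irr true (suc (suc (suc (suc (suc zero))))) = refl
  irr false zero = refl
  irr false (suc zero) = refl
  irr false (suc (suc zero)) = refl
  irr false (suc (suc (suc zero))) = refl
  irr false (suc (suc (suc (suc zero)))) = refl
  irr false (suc (suc (suc (suc (suc zero))))) = refl

data WalkIn (G : Graph) (S : V G → Set) : V G → V G → Set where
  here : ∀ {u} → S u → WalkIn G S u u
  step : ∀ {u w v} → S u → Edge G u w → WalkIn G S w v → WalkIn G S u v

ConnectedIn : (G : Graph) → (V G → Set) → Set
ConnectedIn G S = ∀ u v → S u → S v → WalkIn G S u v

record IsJewel (G : Graph) : Set where
  field
    v1 v2 v3 v4 v5 : V G
    distinct : v1 ≢ v2 × v1 ≢ v3 × v1 ≢ v4 × v1 ≢ v5 × v2 ≢ v3 × v2 ≢ v4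
             × v2 ≢ v5 × v3 ≢ v4 × v3 ≢ v5 × v4 ≢ v5
  InF : V G → Set
  InF x = x ≢ v1 × x ≢ v2 × x ≢ v3 × x ≢ v4 × x ≢ v5
  field
    F-connected : ConnectedIn G InF
    e12 : Edge G v1 v2
    e23 : Edge G v2 v3
    e34 : Edge G v3 v4
    e45 : Edge G v4 v5
    e51 : Edge G v5 v1
    n13 : ¬ Edge G v1 v3
    n24 : ¬ Edge G v2 v4
    n14 : ¬ Edge G v1 v4
    v2-noF : ∀ x → InF x → ¬ Edge G v2 x
    v3-noF : ∀ x → InF x → ¬ Edge G v3 x
    v5-noF : ∀ x → InF x → ¬ Edge G v5 x
    v1-F : Σ (V G) λ x → InF x × Edge G v1 x
    v4-F : Σ (V G) λ x → InF x × Edge G v4 x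

record Path (G : Graph) : Set where
  field
    len : ℕ
    p   : Fin (suc len) → V G
    inj : ∀ i j → p i ≡ p j → i ≡ j
    adj-iff : ∀ i j → (Edge G (p i) (p j) → (toℕ i ≡ suc (toℕ j) ⊎ toℕ j ≡ suc (toℕ i)))
                    × ((toℕ i ≡ suc (toℕ j) ⊎ toℕ j ≡ suc (toℕ i)) → Edge G (p i) (p j))
  first : V G
  first = p zero
  last : V G
  last = p (fromℕ len)

OnPath : {G : Graph} → Path G → V G → Set
OnPath P x = Σ (Fin (suc (Path.len P))) λ i → Path.p P i ≡ x

HasEnds : {G : Graph} → Path G → V G → V G → Set
HasEnds P a b = (Path.first P ≡ a × Path.last P ≡ b) ⊎ (Path.first P ≡ b × Path.last P ≡ a)

PairOK : {G : Graph} → V G → Path G → V G → Path G → V G → Set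
PairOK {G} a Pi bi Pj bj =
    (∀ x → OnPath Pi x → OnPath Pj x → x ≡ a)
  × (∀ x y → OnPath Pi x → x ≢ a → OnPath Pj y → y ≢ a → Edge G x y → x ≡ bi × y ≡ bj)

record IsPyramid (G : Graph) : Set where
  field
    a b1 b2 b3 : V G
    P1 P2 P3 : Path G
    t12 : Edge G b1 b2
    t23 : Edge G b2 b3
    t13 : Edge G b1 b3
    ends1 : HasEnds P1 a b1
    ends2 : HasEnds P2 a b2
    ends3 : HasEnds P3 a b3
    pair12 : PairOK a P1 b1 P2 b2
    pair13 : PairOK a P1 b1 P3 b3
    pair23 : PairOK a P2 b2 P3 b3
    atMostOne : ¬ (Edge G a b1 × Edge G a b2) × ¬ (Edge G a b1 × Edge G a b3)
              × ¬ (Edge G a b2 × Edge G a b3)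
    cover : ∀ x → OnPath P1 x ⊎ OnPath P2 x ⊎ OnPath P3 x

-- In a jewel with neither v₂v₅ nor v₃v₅ an edge, v₁v₂v₃v₄v₅ is an
-- induced C₅. If v₂v₅ is an edge, pick x ∈ F adjacent to v₁: if x ~ v₄ then xv₁v₂v₃v₄ is an
-- induced C₅, otherwise the triangle v₅v₁v₂ with pendants v₄ at v₅ and x at v₁ is a bull; the
-- chord v₃v₅ is the mirror image (v₁ ↔ v₄, v₂ ↔ v₃). In a pyramid, a misses two of the bᵢ, say
-- b₁ and b₂; the triangle with the path-neighbours of b₁ and b₂ as pendants is an induced bull.
-- Injectivity of these embeddings is automatic, since neither C₅ nor the bull has twins.

module Submission where

open import Defs hiding (sym)
open import Data.Bool using (Bool; true)
import Data.Bool as Bool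
open import Data.Bool.Properties using (¬-not)
open import Data.Empty using (⊥-elim)
open import Data.Fin using (Fin; zero; suc; fromℕ; inject₁; _≟_; _<_)
open import Data.Fin.Properties using (any?; all?; <-cmp; toℕ-inject₁)
open import Data.Nat as ℕ using (s≤s)
open import Data.Product using (Σ; ∃-syntax; _×_; _,_; proj₁; proj₂; swap)
open import Data.Sum using (_⊎_; inj₁; inj₂; [_,_]′; map₂)
import Data.Sum as Sum
open import Data.Vec using ([]; _∷_; lookup)
open import Function using (_∘_)
open import Relation.Binary using (tri<; tri≈; tri>)
open import Relation.Binary.PropositionalEquality using (_≡_; _≢_; refl; sym; trans; cong; subst)
open import Relation.Nullary using (¬_; Dec; yes; no)
open import Relation.Nullary.Decidable using (_⊎-dec_; ¬?; toWitness)

Separating : Graph → Set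
Separating H = ∀ i j → i ≡ j ⊎ ∃[ k ] adj H i k ≢ adj H j k

separating? : ∀ H → Dec (Separating H)
separating? H = all? λ i → all? λ j → (i ≟ j) ⊎-dec any? λ k → ¬? (adj H i k Bool.≟ adj H j k)

C5-separating : Separating C5
C5-separating = toWitness {a? = separating? C5} _

bull-separating : Separating bull
bull-separating = toWitness {a? = separating? bull} _

Preserves : (H G : Graph) → (V H → V G) → Set
Preserves H G f = ∀ i j → adj H i j ≡ adj G (f i) (f j)

module _ {H G : Graph} (f : V H → V G) where

  preserves-fromAbove : (∀ i j → i < j → adj H i j ≡ adj G (f i) (f j)) → Preserves H G f
  preserves-fromAbove above i j with <-cmp i j
  ... | tri< i<j _ _ = above i j i<j
  ... | tri≈ _ refl _ = trans (irrefl H i) (sym (irrefl G (f i)))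
  ... | tri> _ _ j<i = trans (Graph.sym H i j) (trans (above j i j<i) (Graph.sym G (f j) (f i)))

  -- Without separation, f could merge two non-adjacent twins of H.
  Preserves⇒injective : Preserves H G f → Separating H → ∀ i j → f i ≡ f j → i ≡ j
  Preserves⇒injective pres separating i j fi≡fj with separating i j
  ... | inj₁ i≡j = i≡j
  ... | inj₂ (k , differ) =
    ⊥-elim (differ (trans (pres i k) (trans (cong (λ z → adj G z (f k)) fi≡fj) (sym (pres j k)))))

  induced : Separating H → Preserves H G f → Contains G H
  induced separating pres = record
    { f = f ; inj = Preserves⇒injective pres separating ; pres = pres }

record JewelCycle (G : Graph) : Set where
  field
    v₁ v₂ v₃ v₄ v₅ : V G
    e₁₂ : Edge G v₁ v₂
    e₂₃ : Edge G v₂ v₃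
    e₃₄ : Edge G v₃ v₄
    e₄₅ : Edge G v₄ v₅
    e₅₁ : Edge G v₅ v₁
    n₁₃ : ¬ Edge G v₁ v₃
    n₂₄ : ¬ Edge G v₂ v₄
    n₁₄ : ¬ Edge G v₁ v₄

module _ {G : Graph} where

  Edge-sym : ∀ {u v} → Edge G u v → Edge G v u
  Edge-sym {u} {v} e = trans (Graph.sym G v u) e

  Edge⇒≢ : ∀ {u v} → Edge G u v → u ≢ v
  Edge⇒≢ {u} e refl with trans (sym (irrefl G u)) e
  ... | ()

  Edge? : ∀ u v → Dec (Edge G u v)
  Edge? u v = adj G u v Bool.≟ true

  C5-induced : (x₀ x₁ x₂ x₃ x₄ : V G) →
    Edge G x₀ x₁ → Edge G x₁ x₂ → Edge G x₂ x₃ → Edge G x₃ x₄ → Edge G x₀ x₄ →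
    ¬ Edge G x₀ x₂ → ¬ Edge G x₀ x₃ → ¬ Edge G x₁ x₃ → ¬ Edge G x₁ x₄ → ¬ Edge G x₂ x₄ →
    Contains G C5
  C5-induced x₀ x₁ x₂ x₃ x₄ e₀₁ e₁₂ e₂₃ e₃₄ e₀₄ n₀₂ n₀₃ n₁₃ n₁₄ n₂₄ =
    induced {C5} {G} x C5-separating (preserves-fromAbove {C5} {G} x above)
    where
    x : V C5 → V G
    x = lookup (x₀ ∷ x₁ ∷ x₂ ∷ x₃ ∷ x₄ ∷ [])
    above : ∀ i j → i < j → adj C5 i j ≡ adj G (x i) (x j)
    above _ zero ()
    above zero (suc zero) _ = sym e₀₁
    above (suc _) (suc zero) (s≤s ())
    above zero (suc (suc zero)) _ = sym (¬-not n₀₂)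
    above (suc zero) (suc (suc zero)) _ = sym e₁₂
    above (suc (suc _)) (suc (suc zero)) (s≤s (s≤s ()))
    above zero (suc (suc (suc zero))) _ = sym (¬-not n₀₃)
    above (suc zero) (suc (suc (suc zero))) _ = sym (¬-not n₁₃)
    above (suc (suc zero)) (suc (suc (suc zero))) _ = sym e₂₃
    above (suc (suc (suc _))) (suc (suc (suc zero))) (s≤s (s≤s (s≤s ())))
    above zero (suc (suc (suc (suc zero)))) _ = sym e₀₄
    above (suc zero) (suc (suc (suc (suc zero)))) _ = sym (¬-not n₁₄)
    above (suc (suc zero)) (suc (suc (suc (suc zero)))) _ = sym (¬-not n₂₄)
    above (suc (suc (suc zero))) (suc (suc (suc (suc zero)))) _ = sym e₃₄
    above (suc (suc (suc (suc _)))) (suc (suc (suc (suc zero)))) (s≤s (s≤s (s≤s (s≤s ()))))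

  bull-induced : (x₀ x₁ x₂ x₃ x₄ : V G) →
    Edge G x₀ x₁ → Edge G x₁ x₂ → Edge G x₀ x₂ → Edge G x₀ x₃ → Edge G x₁ x₄ →
    ¬ Edge G x₀ x₄ → ¬ Edge G x₁ x₃ → ¬ Edge G x₂ x₃ → ¬ Edge G x₂ x₄ → ¬ Edge G x₃ x₄ →
    Contains G bull
  bull-induced x₀ x₁ x₂ x₃ x₄ e₀₁ e₁₂ e₀₂ e₀₃ e₁₄ n₀₄ n₁₃ n₂₃ n₂₄ n₃₄ =
    induced {bull} {G} x bull-separating (preserves-fromAbove {bull} {G} x above)
    where
    x : V bull → V G
    x = lookup (x₀ ∷ x₁ ∷ x₂ ∷ x₃ ∷ x₄ ∷ [])
    above : ∀ i j → i < j → adj bull i j ≡ adj G (x i) (x j)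
    above _ zero ()
    above zero (suc zero) _ = sym e₀₁
    above (suc _) (suc zero) (s≤s ())
    above zero (suc (suc zero)) _ = sym e₀₂
    above (suc zero) (suc (suc zero)) _ = sym e₁₂
    above (suc (suc _)) (suc (suc zero)) (s≤s (s≤s ()))
    above zero (suc (suc (suc zero))) _ = sym e₀₃
    above (suc zero) (suc (suc (suc zero))) _ = sym (¬-not n₁₃)
    above (suc (suc zero)) (suc (suc (suc zero))) _ = sym (¬-not n₂₃)
    above (suc (suc (suc _))) (suc (suc (suc zero))) (s≤s (s≤s (s≤s ())))
    above zero (suc (suc (suc (suc zero)))) _ = sym (¬-not n₀₄)
    above (suc zero) (suc (suc (suc (suc zero)))) _ = sym e₁₄
    above (suc (suc zero)) (suc (suc (suc (suc zero)))) _ = sym (¬-not n₂₄)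
    above (suc (suc (suc zero))) (suc (suc (suc (suc zero)))) _ = sym (¬-not n₃₄)
    above (suc (suc (suc (suc _)))) (suc (suc (suc (suc zero)))) (s≤s (s≤s (s≤s (s≤s ()))))

  reverse : JewelCycle G → JewelCycle G
  reverse C = record
    { v₁ = v₄ ; v₂ = v₃ ; v₃ = v₂ ; v₄ = v₁ ; v₅ = v₅
    ; e₁₂ = Edge-sym e₃₄ ; e₂₃ = Edge-sym e₂₃ ; e₃₄ = Edge-sym e₁₂
    ; e₄₅ = Edge-sym e₅₁ ; e₅₁ = Edge-sym e₄₅
    ; n₁₃ = n₂₄ ∘ Edge-sym ; n₂₄ = n₁₃ ∘ Edge-sym ; n₁₄ = n₁₄ ∘ Edge-sym
    }
    where open JewelCycle C

  module _ (C : JewelCycle G) where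
    open JewelCycle C

    chordless⇒C5 : ¬ Edge G v₂ v₅ → ¬ Edge G v₃ v₅ → Contains G C5
    chordless⇒C5 n₂₅ n₃₅ =
      C5-induced v₁ v₂ v₃ v₄ v₅ e₁₂ e₂₃ e₃₄ e₄₅ (Edge-sym e₅₁) n₁₃ n₁₄ n₂₄ n₂₅ n₃₅

    chord₂₅⇒C5⊎bull : Edge G v₂ v₅ → ∀ x →
      Edge G v₁ x → ¬ Edge G v₂ x → ¬ Edge G v₃ x → ¬ Edge G v₅ x →
      Contains G C5 ⊎ Contains G bull
    chord₂₅⇒C5⊎bull e₂₅ x e₁ₓ n₂ₓ n₃ₓ n₅ₓ with Edge? v₄ x
    ... | yes e₄ₓ = inj₁ (C5-induced x v₁ v₂ v₃ v₄ (Edge-sym e₁ₓ) e₁₂ e₂₃ e₃₄ (Edge-sym e₄ₓ)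
                           (n₂ₓ ∘ Edge-sym) (n₃ₓ ∘ Edge-sym) n₁₃ n₁₄ n₂₄)
    ... | no n₄ₓ = inj₂ (bull-induced v₅ v₁ v₂ v₄ x e₅₁ e₁₂ (Edge-sym e₂₅) (Edge-sym e₄₅) e₁ₓ
                           n₅ₓ n₁₄ n₂₄ n₂ₓ n₄ₓ)

  jewelCycle : IsJewel G → JewelCycle G
  jewelCycle J = record
    { v₁ = v1 ; v₂ = v2 ; v₃ = v3 ; v₄ = v4 ; v₅ = v5
    ; e₁₂ = e12 ; e₂₃ = e23 ; e₃₄ = e34 ; e₄₅ = e45 ; e₅₁ = e51
    ; n₁₃ = n13 ; n₂₄ = n24 ; n₁₄ = n14
    }
    where open IsJewel J

  jewel⇒C5⊎bull : IsJewel G → Contains G C5 ⊎ Contains G bull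
  jewel⇒C5⊎bull J = cases (Edge? v2 v5) (Edge? v3 v5)
    where
    open IsJewel J
    C : JewelCycle G
    C = jewelCycle J
    cases : Dec (Edge G v2 v5) → Dec (Edge G v3 v5) → Contains G C5 ⊎ Contains G bull
    cases (yes e₂₅) _ with v1-F
    ... | x , x∈F , e₁ₓ =
      chord₂₅⇒C5⊎bull C e₂₅ x e₁ₓ (v2-noF x x∈F) (v3-noF x x∈F) (v5-noF x x∈F)
    cases (no _) (yes e₃₅) with v4-F
    ... | y , y∈F , e₄y =
      chord₂₅⇒C5⊎bull (reverse C) e₃₅ y e₄y (v3-noF y y∈F) (v2-noF y y∈F) (v5-noF y y∈F)
    cases (no n₂₅) (no n₃₅) = inj₁ (chordless⇒C5 C n₂₅ n₃₅)

  Path-step : (P : Path G) (i : Fin (Path.len P)) →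
    Edge G (Path.p P (inject₁ i)) (Path.p P (suc i))
  Path-step P i = proj₂ (Path.adj-iff P (inject₁ i) (suc i)) (inj₂ (cong ℕ.suc (sym (toℕ-inject₁ i))))

  HasEnds⇒onPath : ∀ {P : Path G} {a b} → HasEnds P a b → OnPath P a × OnPath P b
  HasEnds⇒onPath {P} (inj₁ (first≡a , last≡b)) = (zero , first≡a) , (fromℕ (Path.len P) , last≡b)
  HasEnds⇒onPath {P} (inj₂ (first≡b , last≡a)) = (fromℕ (Path.len P) , last≡a) , (zero , first≡b)

  HasEnds⇒neighbour : (P : Path G) {a b : V G} → HasEnds P a b → a ≢ b →
    ∃[ c ] OnPath P c × Edge G c b
  HasEnds⇒neighbour record { len = ℕ.zero } (inj₁ (first≡a , last≡b)) a≢b =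
    ⊥-elim (a≢b (trans (sym first≡a) last≡b))
  HasEnds⇒neighbour record { len = ℕ.zero } (inj₂ (first≡b , last≡a)) a≢b =
    ⊥-elim (a≢b (trans (sym last≡a) first≡b))
  HasEnds⇒neighbour P@record { len = ℕ.suc m ; p = p } (inj₁ (_ , last≡b)) _ =
    p (inject₁ (fromℕ m)) , (_ , refl) , subst (Edge G _) last≡b (Path-step P (fromℕ m))
  HasEnds⇒neighbour P@record { len = ℕ.suc _ ; p = p } (inj₂ (first≡b , _)) _ =
    p (suc zero) , (_ , refl) , subst (Edge G _) first≡b (Edge-sym (Path-step P zero))

  PairOK-sym : ∀ {Pᵢ Pⱼ : Path G} {a bᵢ bⱼ} → PairOK a Pᵢ bᵢ Pⱼ bⱼ → PairOK a Pⱼ bⱼ Pᵢ bᵢ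
  PairOK-sym (meet , cross) =
    (λ x x∈Pⱼ x∈Pᵢ → meet x x∈Pᵢ x∈Pⱼ) ,
    (λ x y x∈Pⱼ x≢a y∈Pᵢ y≢a e → swap (cross y x y∈Pᵢ y≢a x∈Pⱼ x≢a (Edge-sym e)))

  swap₁₃ : IsPyramid G → IsPyramid G
  swap₁₃ Py = record
    { a = a ; b1 = b3 ; b2 = b2 ; b3 = b1 ; P1 = P3 ; P2 = P2 ; P3 = P1
    ; t12 = Edge-sym t23 ; t23 = Edge-sym t12 ; t13 = Edge-sym t13
    ; ends1 = ends3 ; ends2 = ends2 ; ends3 = ends1
    ; pair12 = PairOK-sym {P2} {P3} pair23 ; pair13 = PairOK-sym {P1} {P3} pair13
    ; pair23 = PairOK-sym {P1} {P2} pair12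
    ; atMostOne = let n₁₂ , n₁₃ , n₂₃ = atMostOne in n₂₃ ∘ swap , n₁₃ ∘ swap , n₁₂ ∘ swap
    ; cover = [ inj₂ ∘ inj₂ , [ inj₂ ∘ inj₁ , inj₁ ]′ ]′ ∘ cover
    }
    where open IsPyramid Py

  swap₂₃ : IsPyramid G → IsPyramid G
  swap₂₃ Py = record
    { a = a ; b1 = b1 ; b2 = b3 ; b3 = b2 ; P1 = P1 ; P2 = P3 ; P3 = P2
    ; t12 = t13 ; t23 = Edge-sym t23 ; t13 = t12
    ; ends1 = ends1 ; ends2 = ends3 ; ends3 = ends2
    ; pair12 = pair13 ; pair13 = pair12 ; pair23 = PairOK-sym {P2} {P3} pair23
    ; atMostOne = let n₁₂ , n₁₃ , n₂₃ = atMostOne in n₁₃ , n₁₂ , n₂₃ ∘ swap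
    ; cover = map₂ Sum.swap ∘ cover
    }
    where open IsPyramid Py

  module _ (Py : IsPyramid G) where
    open IsPyramid Py

    nonadjacent₁₂⇒bull : ¬ Edge G a b1 → ¬ Edge G a b2 → Contains G bull
    nonadjacent₁₂⇒bull n₁ n₂ =
      bull-at (HasEnds⇒neighbour P1 ends1 (b1≢a ∘ sym)) (HasEnds⇒neighbour P2 ends2 (b2≢a ∘ sym))
      where
      b1≢a : b1 ≢ a
      b1≢a b1≡a = n₂ (subst (λ z → Edge G z b2) b1≡a t12)
      b2≢a : b2 ≢ a
      b2≢a b2≡a = n₁ (subst (λ z → Edge G z b1) b2≡a (Edge-sym t12))
      b3≢a : b3 ≢ a
      b3≢a b3≡a = n₁ (subst (λ z → Edge G z b1) b3≡a (Edge-sym t13))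
      b1∈P1 : OnPath P1 b1
      b1∈P1 = proj₂ (HasEnds⇒onPath {P1} ends1)
      b2∈P2 : OnPath P2 b2
      b2∈P2 = proj₂ (HasEnds⇒onPath {P2} ends2)
      b3∈P3 : OnPath P3 b3
      b3∈P3 = proj₂ (HasEnds⇒onPath {P3} ends3)
      bull-at : ∃[ c ] OnPath P1 c × Edge G c b1 → ∃[ c ] OnPath P2 c × Edge G c b2 → Contains G bull
      bull-at (c₁ , c₁∈P1 , c₁b₁) (c₂ , c₂∈P2 , c₂b₂) =
        -- Each non-edge: an edge between two paths away from a would join their ends bᵢbⱼ.
        bull-induced b1 b2 b3 c₁ c₂ t12 t23 t13 (Edge-sym c₁b₁) (Edge-sym c₂b₂)
          (λ e → Edge⇒≢ c₂b₂ (proj₂ (proj₂ pair12 _ _ b1∈P1 b1≢a c₂∈P2 c₂≢a e)))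
          (λ e → Edge⇒≢ c₁b₁ (proj₁ (proj₂ pair12 _ _ c₁∈P1 c₁≢a b2∈P2 b2≢a (Edge-sym e))))
          (λ e → Edge⇒≢ c₁b₁ (proj₁ (proj₂ pair13 _ _ c₁∈P1 c₁≢a b3∈P3 b3≢a (Edge-sym e))))
          (λ e → Edge⇒≢ c₂b₂ (proj₁ (proj₂ pair23 _ _ c₂∈P2 c₂≢a b3∈P3 b3≢a (Edge-sym e))))
          (λ e → Edge⇒≢ c₁b₁ (proj₁ (proj₂ pair12 _ _ c₁∈P1 c₁≢a c₂∈P2 c₂≢a e)))
        where
        c₁≢a : c₁ ≢ a
        c₁≢a c₁≡a = n₁ (subst (λ z → Edge G z b1) c₁≡a c₁b₁)
        c₂≢a : c₂ ≢ a
        c₂≢a c₂≡a = n₂ (subst (λ z → Edge G z b2) c₂≡a c₂b₂)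

  pyramid⇒bull : IsPyramid G → Contains G bull
  pyramid⇒bull Py = cases (Edge? a b1) (Edge? a b2)
    where
    open IsPyramid Py
    cases : Dec (Edge G a b1) → Dec (Edge G a b2) → Contains G bull
    cases (yes e₁) _ = nonadjacent₁₂⇒bull (swap₁₃ Py)
      (λ e₃ → proj₁ (proj₂ atMostOne) (e₁ , e₃)) (λ e₂ → proj₁ atMostOne (e₁ , e₂))
    cases (no n₁) (yes e₂) =
      nonadjacent₁₂⇒bull (swap₂₃ Py) n₁ (λ e₃ → proj₂ (proj₂ atMostOne) (e₂ , e₃))
    cases (no n₁) (no n₂) = nonadjacent₁₂⇒bull Py n₁ n₂

theorem2p2 : (G : Graph) → IsJewel G ⊎ IsPyramid G →
    Contains G C5 ⊎ Contains G bull ⊎ Σ Bool (λ b → Contains G (anchor b))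
theorem2p2 G (inj₁ J) = map₂ inj₁ (jewel⇒C5⊎bull J)
theorem2p2 G (inj₂ Py) = inj₂ (inj₁ (pyramid⇒bull Py))
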